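{- Let $\mathcal{V}$ be a complete symmetric monoidal closed category with unit $I$ such that $\mathcal{V}(I,-):\mathcal{V}\to\mathbf{Set}$ has a left adjoint, and let $M$ be the functor $M = \delta\circ\mathcal{V}(I,-)$ applied pointwise (so $M$ factors through $\mathbf{Set}$). Let $\Gamma$ be a groupoid, and suppose given: sections $A,B:\Gamma\to\Gamma.\mathbb{L}$; morphisms $f:I\to[El(A),El(B)]$ and $g,h:I\to[El(B),El(A)]$ in $[\Gamma,\mathcal{V}]$; a section $p$ of the identity family of $M[El(A),El(A)]$ between the sections $\sigma(gf)$ and $\sigma(id_{El(A)})$; and a section $q$ of the identity family of $M[El(B),El(B)]$ between the sections $\sigma(fg)$ and $\sigma(id_{El(B)})$. Then there is a natural isomorphism $El(A)\cong El(B)$.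
   Context: $\delta:\mathbf{Set}\to\mathbf{Gpd}$ sends a set to the discrete groupoid on it. Assuming an inaccessible cardinal, $\mathbf{GPD}$ is the category of all groupoids; $\mathbb{L}:\Gamma\to\mathbf{GPD}$ is the functor constant at $\mathcal{V}^{core}$ (the maximal subgroupoid of $\mathcal{V}$). For $X:\Gamma\to\mathbf{GPD}$, $\Gamma.X$ is the Grothendieck construction (objects $(\gamma,x)$, $x\in X(\gamma)$; morphisms $(u,\xi)$ with $u:\gamma\to\gamma'$, $\xi:X(u)(x)\to x'$), and a section is a functor $\Gamma\to\Gamma.X$ right inverse to the projection. A section $A$ of $\Gamma.\mathbb{L}$ amounts to a functor $El(A):\Gamma\to\mathcal{V}$. The functor category $[\Gamma,\mathcal{V}]$ is symmetric monoidal pointwise with internal hom given by the end $[F,G]=\int_{x\in\Gamma}[Fx,Gx]$; morphisms $I\to[F,G]$ correspond to natural transformations $F\Rightarrow G$, and $gf$, $fg$ denote the morphisms corresponding to the composites of the natural transformations corresponding to $f,g$; $id_{El(A)}$ corresponds to the identity. For $Y:\Gamma\to\mathcal{V}$, $MY:\Gamma\to\mathbf{Gpd}$ is $\gamma\mapsto\delta(\mathcal{V}(I,Y(\gamma)))$, and for $u:I\to Y$ in $[\Gamma,\mathcal{V}]$, $\sigma(u)$ is the section $\gamma\mapsto(\gamma,u_\gamma)$ of $\Gamma.MY$. For $X:\Gamma\to\mathbf{Gpd}$ and sections $x,y$ of $\Gamma.X$ (with components $x_\gamma,y_\gamma\in X(\gamma)$), a section of the identity family of $X$ between $x$ and $y$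 is a section of $\Gamma.E$, where $E:\Gamma\to\mathbf{Gpd}$ sends $\gamma$ to the discrete groupoid of morphisms $x_\gamma\to y_\gamma$ in $X(\gamma)$, with the induced functorial action. -}

module Defs where

open import Level using (Level; _⊔_; suc; 0ℓ)
open import Relation.Binary using (IsEquivalence; Setoid)
open import Function.Bundles using (Func)
open import Data.Product using (Σ; _,_; proj₁; proj₂; _×_)
open import Data.Unit.Polymorphic using (⊤; tt)
import Relation.Binary.Reasoning.Setoid as SetoidR

record Category (o ℓ e : Level) : Set (suc (o ⊔ ℓ ⊔ e)) where
  infix  4 _≈_ _⇒_
  infixr 9 _∘_
  field
    Obj       : Set o
    _⇒_       : Obj → Obj → Set ℓ
    _≈_       : ∀ {A B} → A ⇒ B → A ⇒ B → Set e
    id        : ∀ {A} → A ⇒ A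
    _∘_       : ∀ {A B C} → B ⇒ C → A ⇒ B → A ⇒ C
    equiv     : ∀ {A B} → IsEquivalence (_≈_ {A} {B})
    assoc     : ∀ {A B C D} {f : A ⇒ B} {g : B ⇒ C} {h : C ⇒ D} →
                (h ∘ g) ∘ f ≈ h ∘ (g ∘ f)
    identityˡ : ∀ {A B} {f : A ⇒ B} → id ∘ f ≈ f
    identityʳ : ∀ {A B} {f : A ⇒ B} → f ∘ id ≈ f
    ∘-resp-≈  : ∀ {A B C} {f h : B ⇒ C} {g i : A ⇒ B} →
                f ≈ h → g ≈ i → f ∘ g ≈ h ∘ i

  module Equiv {A B} = IsEquivalence (equiv {A} {B})

  hom-setoid : Obj → Obj → Setoid ℓ e
  hom-setoid A B = record { Carrier = A ⇒ B ; _≈_ = _≈_ ; isEquivalence = equiv }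

record Iso {o ℓ e} (C : Category o ℓ e) (A B : Category.Obj C) : Set (ℓ ⊔ e) where
  open Category C
  field
    from : A ⇒ B
    to   : B ⇒ A
    isoˡ : to ∘ from ≈ id
    isoʳ : from ∘ to ≈ id

op : ∀ {o ℓ e} → Category o ℓ e → Category o ℓ e
op C = record
  { Obj = Obj ; _⇒_ = λ A B → B ⇒ A ; _≈_ = _≈_ ; id = id
  ; _∘_ = λ g f → f ∘ g ; equiv = equiv ; assoc = Equiv.sym assoc
  ; identityˡ = identityʳ ; identityʳ = identityˡ
  ; ∘-resp-≈ = λ p q → ∘-resp-≈ q p }
  where open Category C

_×C_ : ∀ {o₁ ℓ₁ e₁ o₂ ℓ₂ e₂} → Category o₁ ℓ₁ e₁ → Category o₂ ℓ₂ e₂ →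
       Category (o₁ ⊔ o₂) (ℓ₁ ⊔ ℓ₂) (e₁ ⊔ e₂)
C ×C D = record
  { Obj = C.Obj × D.Obj
  ; _⇒_ = λ X Y → (proj₁ X C.⇒ proj₁ Y) × (proj₂ X D.⇒ proj₂ Y)
  ; _≈_ = λ f g → (proj₁ f C.≈ proj₁ g) × (proj₂ f D.≈ proj₂ g)
  ; id = C.id , D.id
  ; _∘_ = λ g f → (proj₁ g C.∘ proj₁ f) , (proj₂ g D.∘ proj₂ f)
  ; equiv = record
      { refl = C.Equiv.refl , D.Equiv.refl
      ; sym = λ p → C.Equiv.sym (proj₁ p) , D.Equiv.sym (proj₂ p)
      ; trans = λ p q → C.Equiv.trans (proj₁ p) (proj₁ q) , D.Equiv.trans (proj₂ p) (proj₂ q) }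
  ; assoc = C.assoc , D.assoc
  ; identityˡ = C.identityˡ , D.identityˡ
  ; identityʳ = C.identityʳ , D.identityʳ
  ; ∘-resp-≈ = λ p q → C.∘-resp-≈ (proj₁ p) (proj₁ q) , D.∘-resp-≈ (proj₂ p) (proj₂ q) }
  where
    module C = Category C
    module D = Category D

record Functor {o ℓ e o′ ℓ′ e′} (C : Category o ℓ e) (D : Category o′ ℓ′ e′)
       : Set (o ⊔ ℓ ⊔ e ⊔ o′ ⊔ ℓ′ ⊔ e′) where
  private
    module C = Category C
    module D = Category D
  field
    F₀ : C.Obj → D.Obj
    F₁ : ∀ {A B} → A C.⇒ B → F₀ A D.⇒ F₀ B
    identity     : ∀ {A} → F₁ (C.id {A}) D.≈ D.id
    homomorphism : ∀ {X Y Z} {f : X C.⇒ Y} {g : Y C.⇒ Z} →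
                   F₁ (g C.∘ f) D.≈ F₁ g D.∘ F₁ f
    F-resp-≈     : ∀ {A B} {f g : A C.⇒ B} → f C.≈ g → F₁ f D.≈ F₁ g

idF : ∀ {o ℓ e} {C : Category o ℓ e} → Functor C C
idF {C = C} = record
  { F₀ = λ A → A ; F₁ = λ f → f ; identity = Equiv.refl
  ; homomorphism = Equiv.refl ; F-resp-≈ = λ p → p }
  where open Category C

_∘F_ : ∀ {o₁ ℓ₁ e₁ o₂ ℓ₂ e₂ o₃ ℓ₃ e₃}
         {C : Category o₁ ℓ₁ e₁} {D : Category o₂ ℓ₂ e₂} {E : Category o₃ ℓ₃ e₃} →
       Functor D E → Functor C D → Functor C E
_∘F_ {E = E} G F = record
  { F₀ = λ A → G.F₀ (F.F₀ A)
  ; F₁ = λ f → G.F₁ (F.F₁ f)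
  ; identity = E.Equiv.trans (G.F-resp-≈ F.identity) G.identity
  ; homomorphism = E.Equiv.trans (G.F-resp-≈ F.homomorphism) G.homomorphism
  ; F-resp-≈ = λ p → G.F-resp-≈ (F.F-resp-≈ p) }
  where
    module F = Functor F
    module G = Functor G
    module E = Category E

record NatTrans {o ℓ e o′ ℓ′ e′} {C : Category o ℓ e} {D : Category o′ ℓ′ e′}
       (F G : Functor C D) : Set (o ⊔ ℓ ⊔ ℓ′ ⊔ e′) where
  private
    module C = Category C
    module D = Category D
    module F = Functor F
    module G = Functor G
  field
    η       : ∀ X → F.F₀ X D.⇒ G.F₀ X
    commute : ∀ {X Y} (f : X C.⇒ Y) → η Y D.∘ F.F₁ f D.≈ G.F₁ f D.∘ η X

record NatIso {o ℓ e o′ ℓ′ e′} {C : Category o ℓ e} {D : Category o′ ℓ′ e′}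
       (F G : Functor C D) : Set (o ⊔ ℓ ⊔ ℓ′ ⊔ e′) where
  private
    module D = Category D
  field
    F⇒G  : NatTrans F G
    F⇐G  : NatTrans G F
    isoˡ : ∀ X → NatTrans.η F⇐G X D.∘ NatTrans.η F⇒G X D.≈ D.id
    isoʳ : ∀ X → NatTrans.η F⇒G X D.∘ NatTrans.η F⇐G X D.≈ D.id

record Adjoint {o ℓ e o′ ℓ′ e′} {C : Category o ℓ e} {D : Category o′ ℓ′ e′}
       (L : Functor C D) (R : Functor D C) : Set (o ⊔ ℓ ⊔ e ⊔ o′ ⊔ ℓ′ ⊔ e′) where
  private
    module C = Category C
    module D = Category D
    module L = Functor L
    module R = Functor R
  field
    unit   : NatTrans idF (R ∘F L)
    counit : NatTrans (L ∘F R) idF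
    zig    : ∀ {A} → NatTrans.η counit (L.F₀ A) D.∘ L.F₁ (NatTrans.η unit A) D.≈ D.id
    zag    : ∀ {B} → R.F₁ (NatTrans.η counit B) C.∘ NatTrans.η unit (R.F₀ B) C.≈ C.id

record HasLeftAdjoint {o ℓ e o′ ℓ′ e′} {C : Category o ℓ e} {D : Category o′ ℓ′ e′}
       (R : Functor D C) : Set (o ⊔ ℓ ⊔ e ⊔ o′ ⊔ ℓ′ ⊔ e′) where
  field
    L   : Functor C D
    adj : Adjoint L R

-- The category of setoids (playing the role of Set)

Setoids : ∀ a b → Category (suc (a ⊔ b)) (a ⊔ b) (a ⊔ b)
Setoids a b = record
  { Obj = Setoid a b
  ; _⇒_ = λ S T → Func S T
  ; _≈_ = λ {S} {T} f g → ∀ x → Setoid._≈_ T (Func.to f x) (Func.to g x)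
  ; id = λ {S} → record { to = λ x → x ; cong = λ p → p }
  ; _∘_ = λ g f → record { to = λ x → Func.to g (Func.to f x)
                         ; cong = λ p → Func.cong g (Func.cong f p) }
  ; equiv = λ {S} {T} → record
      { refl = λ x → Setoid.refl T
      ; sym = λ p x → Setoid.sym T (p x)
      ; trans = λ p q x → Setoid.trans T (p x) (q x) }
  ; assoc = λ {_} {_} {_} {D} x → Setoid.refl D
  ; identityˡ = λ {_} {B} x → Setoid.refl B
  ; identityʳ = λ {_} {B} x → Setoid.refl B
  ; ∘-resp-≈ = λ {_} {_} {C} {f} {h} {g} {i} p q x →
      Setoid.trans C (Func.cong f (q x)) (p (Func.to i x)) }

module _ {o ℓ e o′ ℓ′ e′} {J : Category o′ ℓ′ e′} {C : Category o ℓ e} where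
  private
    module C = Category C
    module J = Category J

  record Cone (D : Functor J C) : Set (o ⊔ ℓ ⊔ e ⊔ o′ ⊔ ℓ′) where
    field
      apex    : C.Obj
      proj    : ∀ j → apex C.⇒ Functor.F₀ D j
      commute : ∀ {i j} (u : i J.⇒ j) → Functor.F₁ D u C.∘ proj i C.≈ proj j

  record Limit (D : Functor J C) : Set (o ⊔ ℓ ⊔ e ⊔ o′ ⊔ ℓ′) where
    field
      cone           : Cone D
      factor         : (K : Cone D) → Cone.apex K C.⇒ Cone.apex cone
      factor-commute : ∀ (K : Cone D) j →
                       Cone.proj cone j C.∘ factor K C.≈ Cone.proj K j
      unique         : ∀ (K : Cone D) (h : Cone.apex K C.⇒ Cone.apex cone) →
                       (∀ j → Cone.proj cone j C.∘ h C.≈ Cone.proj K j) →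
                       h C.≈ factor K

Complete : ∀ {o ℓ e} (o′ ℓ′ e′ : Level) → Category o ℓ e → Set _
Complete o′ ℓ′ e′ C = ∀ {J : Category o′ ℓ′ e′} (D : Functor J C) → Limit D

record SymmetricMonoidalClosed {o ℓ e} (V : Category o ℓ e) : Set (o ⊔ ℓ ⊔ e) where
  open Category V
  field
    ⊗    : Functor (V ×C V) V
    unit : Obj

  infixr 10 _⊗₀_ _⊗₁_
  _⊗₀_ : Obj → Obj → Obj
  A ⊗₀ B = Functor.F₀ ⊗ (A , B)

  _⊗₁_ : ∀ {A B C D} → A ⇒ B → C ⇒ D → (A ⊗₀ C) ⇒ (B ⊗₀ D)
  f ⊗₁ g = Functor.F₁ ⊗ (f , g)

  field
    associator : ∀ {X Y Z} → Iso V ((X ⊗₀ Y) ⊗₀ Z) (X ⊗₀ (Y ⊗₀ Z))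
    unitorˡ    : ∀ {X} → Iso V (unit ⊗₀ X) X
    unitorʳ    : ∀ {X} → Iso V (X ⊗₀ unit) X
    braiding   : ∀ {X Y} → Iso V (X ⊗₀ Y) (Y ⊗₀ X)

  α : ∀ {X Y Z} → ((X ⊗₀ Y) ⊗₀ Z) ⇒ (X ⊗₀ (Y ⊗₀ Z))
  α = Iso.from associator
  λ⇒ : ∀ {X} → (unit ⊗₀ X) ⇒ X
  λ⇒ = Iso.from unitorˡ
  ρ⇒ : ∀ {X} → (X ⊗₀ unit) ⇒ X
  ρ⇒ = Iso.from unitorʳ
  σ⇒ : ∀ {X Y} → (X ⊗₀ Y) ⇒ (Y ⊗₀ X)
  σ⇒ = Iso.from braiding

  field
    assoc-commute    : ∀ {X X′ Y Y′ Z Z′} {f : X ⇒ X′} {g : Y ⇒ Y′} {h : Z ⇒ Z′} →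
                       α ∘ ((f ⊗₁ g) ⊗₁ h) ≈ (f ⊗₁ (g ⊗₁ h)) ∘ α
    unitorˡ-commute  : ∀ {X Y} {f : X ⇒ Y} → λ⇒ ∘ (id {unit} ⊗₁ f) ≈ f ∘ λ⇒
    unitorʳ-commute  : ∀ {X Y} {f : X ⇒ Y} → ρ⇒ ∘ (f ⊗₁ id {unit}) ≈ f ∘ ρ⇒
    braiding-commute : ∀ {X X′ Y Y′} {f : X ⇒ X′} {g : Y ⇒ Y′} →
                       σ⇒ ∘ (f ⊗₁ g) ≈ (g ⊗₁ f) ∘ σ⇒
    triangle  : ∀ {X Y} → (id {X} ⊗₁ λ⇒ {Y}) ∘ α {X} {unit} {Y} ≈ ρ⇒ {X} ⊗₁ id {Y}
    pentagon  : ∀ {X Y Z W} →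
                (id {X} ⊗₁ α {Y} {Z} {W}) ∘ (α {X} {Y ⊗₀ Z} {W} ∘ (α {X} {Y} {Z} ⊗₁ id {W}))
                ≈ α {X} {Y} {Z ⊗₀ W} ∘ α {X ⊗₀ Y} {Z} {W}
    hexagon   : ∀ {X Y Z} →
                α {Y} {Z} {X} ∘ (σ⇒ {X} {Y ⊗₀ Z} ∘ α {X} {Y} {Z})
                ≈ (id {Y} ⊗₁ σ⇒ {X} {Z}) ∘ (α {Y} {X} {Z} ∘ (σ⇒ {X} {Y} ⊗₁ id {Z}))
    symmetry  : ∀ {X Y} → σ⇒ {Y} {X} ∘ σ⇒ {X} {Y} ≈ id

    [-,-] : Functor (op V ×C V) V

  [_,_]₀ : Obj → Obj → Obj
  [ A , B ]₀ = Functor.F₀ [-,-] (A , B)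

  [_,_]₁ : ∀ {A B C D} → B ⇒ A → C ⇒ D → [ A , C ]₀ ⇒ [ B , D ]₀
  [ f , g ]₁ = Functor.F₁ [-,-] (f , g)

  field
    curry          : ∀ {A B C} → (A ⊗₀ B) ⇒ C → A ⇒ [ B , C ]₀
    uncurry        : ∀ {A B C} → A ⇒ [ B , C ]₀ → (A ⊗₀ B) ⇒ C
    curry-resp-≈   : ∀ {A B C} {f g : (A ⊗₀ B) ⇒ C} → f ≈ g → curry f ≈ curry g
    uncurry-resp-≈ : ∀ {A B C} {f g : A ⇒ [ B , C ]₀} → f ≈ g → uncurry f ≈ uncurry g
    curry-uncurry  : ∀ {A B C} {f : A ⇒ [ B , C ]₀} → curry (uncurry f) ≈ f
    uncurry-curry  : ∀ {A B C} {f : (A ⊗₀ B) ⇒ C} → uncurry (curry f) ≈ f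
    curry-natural  : ∀ {A A′ B B′ C C′} {a : A′ ⇒ A} {b : B′ ⇒ B} {c : C ⇒ C′}
                       {f : (A ⊗₀ B) ⇒ C} →
                     curry (c ∘ (f ∘ (a ⊗₁ b))) ≈ [ b , c ]₁ ∘ (curry f ∘ a)

HomI : ∀ {o ℓ e} (V : Category o ℓ e) → SymmetricMonoidalClosed V →
       Functor V (Setoids ℓ e)
HomI V SMC = record
  { F₀ = λ Y → hom-setoid unit Y
  ; F₁ = λ f → record { to = λ u → f ∘ u ; cong = λ p → ∘-resp-≈ Equiv.refl p }
  ; identity = λ u → identityˡ
  ; homomorphism = λ u → assoc
  ; F-resp-≈ = λ p u → ∘-resp-≈ p Equiv.refl }
  where
    open Category V
    open SymmetricMonoidalClosed SMC using (unit)

record Groupoid (o ℓ e : Level) : Set (suc (o ⊔ ℓ ⊔ e)) where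
  field
    category : Category o ℓ e
  open Category category public
  field
    inv  : ∀ {A B} → A ⇒ B → B ⇒ A
    invˡ : ∀ {A B} {f : A ⇒ B} → inv f ∘ f ≈ id
    invʳ : ∀ {A B} {f : A ⇒ B} → f ∘ inv f ≈ id

Core : ∀ {o ℓ e} → Category o ℓ e → Groupoid o (ℓ ⊔ e) e
Core {o} {ℓ} {e} V = record
  { category = record
    { Obj = Obj
    ; _⇒_ = Iso V
    ; _≈_ = λ f g → Iso.from f ≈ Iso.from g
    ; id = record { from = id ; to = id ; isoˡ = identityˡ ; isoʳ = identityˡ }
    ; _∘_ = comp
    ; equiv = record { refl = Equiv.refl ; sym = Equiv.sym ; trans = Equiv.trans }
    ; assoc = assoc
    ; identityˡ = identityˡ
    ; identityʳ = identityʳ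
    ; ∘-resp-≈ = ∘-resp-≈ }
  ; inv = λ f → record { from = Iso.to f ; to = Iso.from f
                       ; isoˡ = Iso.isoʳ f ; isoʳ = Iso.isoˡ f }
  ; invˡ = λ {_} {_} {f} → Iso.isoˡ f
  ; invʳ = λ {_} {_} {f} → Iso.isoʳ f }
  where
    open Category V
    cancel : ∀ {A B C} (p : B ⇒ A) (q : A ⇒ B) (r : C ⇒ B) (s : B ⇒ C) →
             q ∘ p ≈ id → s ∘ r ≈ id → (s ∘ q) ∘ (p ∘ r) ≈ id
    cancel p q r s qp sr = begin
        (s ∘ q) ∘ (p ∘ r) ≈⟨ assoc ⟩
        s ∘ (q ∘ (p ∘ r)) ≈⟨ ∘-resp-≈ Equiv.refl (Equiv.sym assoc) ⟩
        s ∘ ((q ∘ p) ∘ r) ≈⟨ ∘-resp-≈ Equiv.refl (∘-resp-≈ qp Equiv.refl) ⟩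
        s ∘ (id ∘ r)      ≈⟨ ∘-resp-≈ Equiv.refl identityˡ ⟩
        s ∘ r             ≈⟨ sr ⟩
        id ∎
      where open SetoidR (hom-setoid _ _)
    comp : ∀ {A B C} → Iso V B C → Iso V A B → Iso V A C
    comp g f = record
      { from = Iso.from g ∘ Iso.from f
      ; to   = Iso.to f ∘ Iso.to g
      ; isoˡ = cancel (Iso.from g) (Iso.to g) (Iso.from f) (Iso.to f) (Iso.isoˡ g) (Iso.isoˡ f)
      ; isoʳ = cancel (Iso.to f) (Iso.from f) (Iso.to g) (Iso.from g) (Iso.isoʳ f) (Iso.isoʳ g) }

-- δ : the discrete groupoid on a set (here: on a setoid; morphisms x → y
-- are witnesses of x ≈ y, all parallel morphisms being equal)
δ : ∀ {a b} → Setoid a b → Groupoid a b 0ℓ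
δ S = record
  { category = record
    { Obj = Carrier
    ; _⇒_ = _≈_
    ; _≈_ = λ _ _ → ⊤
    ; id = refl
    ; _∘_ = λ q p → trans p q
    ; equiv = record { refl = tt ; sym = λ _ → tt ; trans = λ _ _ → tt }
    ; assoc = tt ; identityˡ = tt ; identityʳ = tt ; ∘-resp-≈ = λ _ _ → tt }
  ; inv = sym ; invˡ = tt ; invʳ = tt }
  where open Setoid S

-- Sections of Γ.X for a family X : Γ → GPD that is constant at a
-- groupoid G (so X(u) is the identity functor).  A section of the
-- Grothendieck construction Γ.X (a functor Γ → Γ.X right inverse to the
-- projection) unfolds to: an object x_γ ∈ G for each γ, and a morphism
-- x_u : x_γ → x_γ′ in G for each u : γ → γ′, functorially.

record ConstSection {c o ℓ e} (Γ : Groupoid c c c) (G : Groupoid o ℓ e)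
       : Set (c ⊔ o ⊔ ℓ ⊔ e) where
  private
    module Γ = Groupoid Γ
    module G = Groupoid G
  field
    obj      : Γ.Obj → G.Obj
    mor      : ∀ {γ γ′} → γ Γ.⇒ γ′ → obj γ G.⇒ obj γ′
    mor-resp : ∀ {γ γ′} {u v : γ Γ.⇒ γ′} → u Γ.≈ v → mor u G.≈ mor v
    mor-id   : ∀ {γ} → mor (Γ.id {γ}) G.≈ G.id
    mor-∘    : ∀ {γ γ′ γ″} {u : γ Γ.⇒ γ′} {v : γ′ Γ.⇒ γ″} →
               mor (v Γ.∘ u) G.≈ mor v G.∘ mor u

-- A section of the identity family E of (the constant family at) G between
-- sections x and y: E(γ) is the discrete groupoid on the set of morphisms
-- x_γ → y_γ in G, with E(u)(ε) = y_u ∘ ε ∘ x_u⁻¹.  A section of Γ.E gives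
-- ε_γ : x_γ → y_γ and, for u : γ → γ′, a morphism E(u)(ε_γ) → ε_γ′ in the
-- discrete groupoid, i.e. an equality.
record IdSection {c o ℓ e} {Γ : Groupoid c c c} {G : Groupoid o ℓ e}
       (x y : ConstSection Γ G) : Set (c ⊔ ℓ ⊔ e) where
  private
    module Γ = Groupoid Γ
    module G = Groupoid G
    module x = ConstSection x
    module y = ConstSection y
  field
    ε   : ∀ γ → x.obj γ G.⇒ y.obj γ
    nat : ∀ {γ γ′} (u : γ Γ.⇒ γ′) →
          (y.mor u G.∘ ε γ) G.∘ G.inv (x.mor u) G.≈ ε γ′

-- a section of Γ.𝕃 (𝕃 constant at V^core)
SectionL : ∀ {c o ℓ e} (V : Category o ℓ e) (Γ : Groupoid c c c) → Set _
SectionL V Γ = ConstSection Γ (Core V)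

El : ∀ {c o ℓ e} (V : Category o ℓ e) (Γ : Groupoid c c c) →
     SectionL V Γ → Functor (Groupoid.category Γ) V
El V Γ A = record
  { F₀ = obj ; F₁ = λ u → Iso.from (mor u)
  ; identity = mor-id ; homomorphism = mor-∘ ; F-resp-≈ = mor-resp }
  where open ConstSection A

-- twisted arrow category of C (the end of H : Cᵒᵖ × C → V is the limit of
-- the induced diagram on Tw(C))
Tw : ∀ {c} → Category c c c → Category c c c
Tw C = record
  { Obj = Σ Obj (λ x → Σ Obj (λ y → x ⇒ y))
  ; _⇒_ = λ X Y → Σ ((proj₁ Y ⇒ proj₁ X) × (proj₁ (proj₂ X) ⇒ proj₁ (proj₂ Y)))
                    (λ ab → (proj₂ ab ∘ (proj₂ (proj₂ X) ∘ proj₁ ab)) ≈ proj₂ (proj₂ Y))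
  ; _≈_ = λ f g → (proj₁ (proj₁ f) ≈ proj₁ (proj₁ g)) × (proj₂ (proj₁ f) ≈ proj₂ (proj₁ g))
  ; id = (id , id) , Equiv.trans identityˡ identityʳ
  ; _∘_ = λ g f → ((proj₁ (proj₁ f) ∘ proj₁ (proj₁ g)) , (proj₂ (proj₁ g) ∘ proj₂ (proj₁ f)))
                  , comp-ok (proj₂ f) (proj₂ g)
  ; equiv = record
      { refl = Equiv.refl , Equiv.refl
      ; sym = λ p → Equiv.sym (proj₁ p) , Equiv.sym (proj₂ p)
      ; trans = λ p q → Equiv.trans (proj₁ p) (proj₁ q) , Equiv.trans (proj₂ p) (proj₂ q) }
  ; assoc = Equiv.sym assoc , assoc
  ; identityˡ = identityʳ , identityˡ
  ; identityʳ = identityˡ , identityʳ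
  ; ∘-resp-≈ = λ p q → ∘-resp-≈ (proj₁ q) (proj₁ p) , ∘-resp-≈ (proj₂ p) (proj₂ q) }
  where
    open Category C
    comp-ok : ∀ {x y x′ y′ x″ y″} {u : x ⇒ y} {u′ : x′ ⇒ y′} {u″ : x″ ⇒ y″}
                {a : x′ ⇒ x} {b : y ⇒ y′} {a′ : x″ ⇒ x′} {b′ : y′ ⇒ y″} →
              b ∘ (u ∘ a) ≈ u′ → b′ ∘ (u′ ∘ a′) ≈ u″ →
              (b′ ∘ b) ∘ (u ∘ (a ∘ a′)) ≈ u″
    comp-ok {u = u} {a = a} {b = b} {a′ = a′} {b′ = b′} p q = begin
        (b′ ∘ b) ∘ (u ∘ (a ∘ a′)) ≈⟨ assoc ⟩
        b′ ∘ (b ∘ (u ∘ (a ∘ a′))) ≈⟨ ∘-resp-≈ Equiv.refl (∘-resp-≈ Equiv.refl (Equiv.sym assoc)) ⟩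
        b′ ∘ (b ∘ ((u ∘ a) ∘ a′)) ≈⟨ ∘-resp-≈ Equiv.refl (Equiv.sym assoc) ⟩
        b′ ∘ ((b ∘ (u ∘ a)) ∘ a′) ≈⟨ ∘-resp-≈ Equiv.refl (∘-resp-≈ p Equiv.refl) ⟩
        b′ ∘ (_ ∘ a′)             ≈⟨ q ⟩
        _ ∎
      where open SetoidR (hom-setoid _ _)

module _ {c o ℓ e} (V : Category o ℓ e) (SMC : SymmetricMonoidalClosed V)
         (complete : Complete c c c V) (Γ : Groupoid c c c) where
  private
    module V = Category V
    module Γ = Groupoid Γ
  open SymmetricMonoidalClosed SMC

  endDiagram : (F G : Functor Γ.category V) → Functor (Tw Γ.category) V
  endDiagram F G = record
    { F₀ = λ X → [ F.F₀ (proj₁ X) , G.F₀ (proj₁ (proj₂ X)) ]₀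
    ; F₁ = λ f → [ F.F₁ (proj₁ (proj₁ f)) , G.F₁ (proj₂ (proj₁ f)) ]₁
    ; identity = V.Equiv.trans (Functor.F-resp-≈ [-,-] (F.identity , G.identity))
                               (Functor.identity [-,-])
    ; homomorphism = V.Equiv.trans
        (Functor.F-resp-≈ [-,-] (F.homomorphism , G.homomorphism))
        (Functor.homomorphism [-,-])
    ; F-resp-≈ = λ p → Functor.F-resp-≈ [-,-] (F.F-resp-≈ (proj₁ p) , G.F-resp-≈ (proj₂ p)) }
    where
      module F = Functor F
      module G = Functor G

  -- [F , G] = ∫_{x ∈ Γ} [F x , G x], computed by the completeness of V
  End : (F G : Functor Γ.category V) → V.Obj
  End F G = Cone.apex (Limit.cone (complete (endDiagram F G)))

  πEnd : (F G : Functor Γ.category V) (x : Γ.Obj) →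
         End F G V.⇒ [ Functor.F₀ F x , Functor.F₀ G x ]₀
  πEnd F G x = Cone.proj (Limit.cone (complete (endDiagram F G))) (x , x , Γ.id)

  toNat : (F G : Functor Γ.category V) → unit V.⇒ End F G →
          (x : Γ.Obj) → Functor.F₀ F x V.⇒ Functor.F₀ G x
  toNat F G k x = uncurry (πEnd F G x V.∘ k) V.∘ Iso.to unitorˡ

  Corresponds : (F G : Functor Γ.category V) → unit V.⇒ End F G →
                ((x : Γ.Obj) → Functor.F₀ F x V.⇒ Functor.F₀ G x) → Set (c ⊔ e)
  Corresponds F G k θ = ∀ x → toNat F G k x V.≈ θ x

  -- M Y = δ ∘ V(I, Y(-)) for Y the (constant) object [F , G], and the
  -- section σ(k) : γ ↦ (γ , k)
  M : (F G : Functor Γ.category V) → Groupoid ℓ e 0ℓ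
  M F G = δ (V.hom-setoid unit (End F G))

  σ : (F G : Functor Γ.category V) → unit V.⇒ End F G → ConstSection Γ (M F G)
  σ F G k = record
    { obj = λ _ → k ; mor = λ _ → V.Equiv.refl
    ; mor-resp = λ _ → tt ; mor-id = tt ; mor-∘ = tt }

module Submission where

open import Defs

open import Data.Product using (_,_)
import Relation.Binary.Reasoning.Setoid as SetoidR

-- Every global element k : I → [F , G] of the end
-- ∫_x [F x , G x] determines a natural transformation F ⇒ G: its component
-- at x is the morphism F x → G x whose name is the projection π_x ∘ k, and
-- naturality is exactly the wedge condition of the end, transported along
-- the naturality of "taking the morphism named by a global element".  So f
-- and g give transformations El(A) ⇄ El(B).  A section of the identity family
-- of M[F , G] = δ(V(I , [F , G])) between σ(k) and σ(k′) supplies, at any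
-- point of Γ, a proof that k ≈ k′; hence transformations corresponding to
-- k and k′ agree.  Applied to p and q this says g ∘ f = id and f ∘ g = id
-- pointwise, which makes the two transformations a natural isomorphism.

module _ {o ℓ e} (C : Category o ℓ e) where
  open Category C

  inverse-square : ∀ {A B A′ B′} (i : Iso C A B) (j : Iso C A′ B′) {a : A ⇒ A′} {b : B ⇒ B′} →
                   Iso.from j ∘ a ≈ b ∘ Iso.from i → a ∘ Iso.to i ≈ Iso.to j ∘ b
  inverse-square i j {a} {b} square = begin
      a ∘ Iso.to i                                ≈⟨ Equiv.sym identityˡ ⟩
      id ∘ (a ∘ Iso.to i)                         ≈⟨ ∘-resp-≈ (Equiv.sym (Iso.isoˡ j)) Equiv.refl ⟩
      (Iso.to j ∘ Iso.from j) ∘ (a ∘ Iso.to i)    ≈⟨ assoc ⟩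
      Iso.to j ∘ (Iso.from j ∘ (a ∘ Iso.to i))    ≈⟨ ∘-resp-≈ Equiv.refl (Equiv.sym assoc) ⟩
      Iso.to j ∘ ((Iso.from j ∘ a) ∘ Iso.to i)    ≈⟨ ∘-resp-≈ Equiv.refl (∘-resp-≈ square Equiv.refl) ⟩
      Iso.to j ∘ ((b ∘ Iso.from i) ∘ Iso.to i)    ≈⟨ ∘-resp-≈ Equiv.refl assoc ⟩
      Iso.to j ∘ (b ∘ (Iso.from i ∘ Iso.to i))    ≈⟨ ∘-resp-≈ Equiv.refl (∘-resp-≈ Equiv.refl (Iso.isoʳ i)) ⟩
      Iso.to j ∘ (b ∘ id)                         ≈⟨ ∘-resp-≈ Equiv.refl identityʳ ⟩
      Iso.to j ∘ b                                ∎
    where open SetoidR (hom-setoid _ _)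

module Names {o ℓ e} (V : Category o ℓ e) (SMC : SymmetricMonoidalClosed V) where
  open Category V
  open SymmetricMonoidalClosed SMC

  unname : ∀ {X Y} → unit ⇒ [ X , Y ]₀ → X ⇒ Y
  unname m = uncurry m ∘ Iso.to unitorˡ

  unname-resp-≈ : ∀ {X Y} {m m′ : unit ⇒ [ X , Y ]₀} → m ≈ m′ → unname m ≈ unname m′
  unname-resp-≈ m≈m′ = ∘-resp-≈ (uncurry-resp-≈ m≈m′) Equiv.refl

  unitorˡ⁻¹-commute : ∀ {X Y} {a : X ⇒ Y} → (id ⊗₁ a) ∘ Iso.to unitorˡ ≈ Iso.to unitorˡ ∘ a
  unitorˡ⁻¹-commute = inverse-square V unitorˡ unitorˡ unitorˡ-commute

  uncurry-natural : ∀ {A B B′ C C′} {a : B′ ⇒ B} {b : C ⇒ C′} {m : A ⇒ [ B , C ]₀} →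
                    uncurry ([ a , b ]₁ ∘ m) ≈ b ∘ (uncurry m ∘ (id ⊗₁ a))
  uncurry-natural {a = a} {b} {m} = begin
      uncurry ([ a , b ]₁ ∘ m)                         ≈⟨ uncurry-resp-≈ (∘-resp-≈ Equiv.refl m≈curried) ⟩
      uncurry ([ a , b ]₁ ∘ (curry (uncurry m) ∘ id))  ≈⟨ uncurry-resp-≈ (Equiv.sym curry-natural) ⟩
      uncurry (curry (b ∘ (uncurry m ∘ (id ⊗₁ a))))    ≈⟨ uncurry-curry ⟩
      b ∘ (uncurry m ∘ (id ⊗₁ a))                      ∎
    where
      open SetoidR (hom-setoid _ _)
      m≈curried : m ≈ curry (uncurry m) ∘ id
      m≈curried = Equiv.sym (Equiv.trans identityʳ curry-uncurry)

  unname-natural : ∀ {X X′ Y Y′} {a : X′ ⇒ X} {b : Y ⇒ Y′} (m : unit ⇒ [ X , Y ]₀) →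
                   unname ([ a , b ]₁ ∘ m) ≈ b ∘ (unname m ∘ a)
  unname-natural {a = a} {b} m = begin
      uncurry ([ a , b ]₁ ∘ m) ∘ Iso.to unitorˡ           ≈⟨ ∘-resp-≈ uncurry-natural Equiv.refl ⟩
      (b ∘ (uncurry m ∘ (id ⊗₁ a))) ∘ Iso.to unitorˡ      ≈⟨ assoc ⟩
      b ∘ ((uncurry m ∘ (id ⊗₁ a)) ∘ Iso.to unitorˡ)      ≈⟨ ∘-resp-≈ Equiv.refl assoc ⟩
      b ∘ (uncurry m ∘ ((id ⊗₁ a) ∘ Iso.to unitorˡ))      ≈⟨ ∘-resp-≈ Equiv.refl (∘-resp-≈ Equiv.refl unitorˡ⁻¹-commute) ⟩
      b ∘ (uncurry m ∘ (Iso.to unitorˡ ∘ a))              ≈⟨ ∘-resp-≈ Equiv.refl (Equiv.sym assoc) ⟩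
      b ∘ (unname m ∘ a)                                  ∎
    where open SetoidR (hom-setoid _ _)

module EndElements {c o ℓ e} (V : Category o ℓ e) (SMC : SymmetricMonoidalClosed V)
         (complete : Complete c c c V) (Γ : Groupoid c c c) where
  open Category V
  open SymmetricMonoidalClosed SMC
  open Names V SMC
  private
    module Γ = Groupoid Γ

  module _ (F G : Functor Γ.category V) where
    private
      module F = Functor F
      module G = Functor G
      wedge = Limit.cone (complete (endDiagram V SMC complete Γ F G))
      π = Cone.proj wedge

    wedge-left : ∀ {X Y} (u : X Γ.⇒ Y) → [ F.F₁ u , G.F₁ Γ.id ]₁ ∘ π (Y , Y , Γ.id) ≈ π (X , Y , u)
    wedge-left u = Cone.commute wedge ((u , Γ.id) , Γ.Equiv.trans Γ.identityˡ Γ.identityˡ)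

    wedge-right : ∀ {X Y} (u : X Γ.⇒ Y) → [ F.F₁ Γ.id , G.F₁ u ]₁ ∘ π (X , X , Γ.id) ≈ π (X , Y , u)
    wedge-right u = Cone.commute wedge
      ((Γ.id , u) , Γ.Equiv.trans (Γ.∘-resp-≈ Γ.Equiv.refl Γ.identityˡ) Γ.identityʳ)

    toNat-natural : (k : unit ⇒ End V SMC complete Γ F G) {X Y : Γ.Obj} (u : X Γ.⇒ Y) →
                    toNat V SMC complete Γ F G k Y ∘ F.F₁ u ≈ G.F₁ u ∘ toNat V SMC complete Γ F G k X
    toNat-natural k {X} {Y} u = begin
        unname (π (Y , Y , Γ.id) ∘ k) ∘ F.F₁ u                      ≈⟨ Equiv.sym (identity-post G.identity) ⟩
        G.F₁ Γ.id ∘ (unname (π (Y , Y , Γ.id) ∘ k) ∘ F.F₁ u)        ≈⟨ Equiv.sym (unname-natural _) ⟩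
        unname ([ F.F₁ u , G.F₁ Γ.id ]₁ ∘ (π (Y , Y , Γ.id) ∘ k))   ≈⟨ unname-resp-≈ (through (wedge-left u)) ⟩
        unname (π (X , Y , u) ∘ k)                                  ≈⟨ unname-resp-≈ (Equiv.sym (through (wedge-right u))) ⟩
        unname ([ F.F₁ Γ.id , G.F₁ u ]₁ ∘ (π (X , X , Γ.id) ∘ k))   ≈⟨ unname-natural _ ⟩
        G.F₁ u ∘ (unname (π (X , X , Γ.id) ∘ k) ∘ F.F₁ Γ.id)        ≈⟨ ∘-resp-≈ Equiv.refl (identity-pre F.identity) ⟩
        G.F₁ u ∘ unname (π (X , X , Γ.id) ∘ k)                      ∎
      where
        open SetoidR (hom-setoid _ _)
        through : ∀ {B C} {s : B ⇒ C} {t : End V SMC complete Γ F G ⇒ B} {r : End V SMC complete Γ F G ⇒ C} → s ∘ t ≈ r → s ∘ (t ∘ k) ≈ r ∘ k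
        through st≈r = Equiv.trans (Equiv.sym assoc) (∘-resp-≈ st≈r Equiv.refl)
        identity-post : ∀ {A B} {i : B ⇒ B} {t : A ⇒ B} → i ≈ id → i ∘ t ≈ t
        identity-post i≈id = Equiv.trans (∘-resp-≈ i≈id Equiv.refl) identityˡ
        identity-pre : ∀ {A B} {i : A ⇒ A} {t : A ⇒ B} → i ≈ id → t ∘ i ≈ t
        identity-pre i≈id = Equiv.trans (∘-resp-≈ Equiv.refl i≈id) identityʳ

    toNatTrans : unit ⇒ End V SMC complete Γ F G → NatTrans F G
    toNatTrans k = record { η = toNat V SMC complete Γ F G k ; commute = toNat-natural k }

    -- identified sections σ(k), σ(k′) of M[F , G] yield equal transformations:
    -- each component of the identity section is a proof that k ≈ k′
    identified-correspond : ∀ {k k′ θ θ′} →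
      Corresponds V SMC complete Γ F G k θ → Corresponds V SMC complete Γ F G k′ θ′ →
      IdSection (σ V SMC complete Γ F G k) (σ V SMC complete Γ F G k′) → ∀ x → θ x ≈ θ′ x
    identified-correspond k~θ k′~θ′ path x = begin
        _                                       ≈⟨ Equiv.sym (k~θ x) ⟩
        unname (πEnd V SMC complete Γ F G x ∘ _) ≈⟨ unname-resp-≈ (∘-resp-≈ Equiv.refl (IdSection.ε path x)) ⟩
        unname (πEnd V SMC complete Γ F G x ∘ _) ≈⟨ k′~θ′ x ⟩
        _                                       ∎
      where open SetoidR (hom-setoid _ _)

mainTheorem8 : ∀ {o ℓ e c}
    (V : Category o ℓ e)
    (SMC : SymmetricMonoidalClosed V)
    (complete : Complete c c c V)
    (leftAdj : HasLeftAdjoint (HomI V SMC))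
    (Γ : Groupoid c c c)
    (A B : SectionL V Γ)
    (f : Category._⇒_ V (SymmetricMonoidalClosed.unit SMC) (End V SMC complete Γ (El V Γ A) (El V Γ B)))
    (g h : Category._⇒_ V (SymmetricMonoidalClosed.unit SMC) (End V SMC complete Γ (El V Γ B) (El V Γ A)))
    (gf : Category._⇒_ V (SymmetricMonoidalClosed.unit SMC) (End V SMC complete Γ (El V Γ A) (El V Γ A)))
    → Corresponds V SMC complete Γ (El V Γ A) (El V Γ A) gf
    (λ x → Category._∘_ V (toNat V SMC complete Γ (El V Γ B) (El V Γ A) g x)
    (toNat V SMC complete Γ (El V Γ A) (El V Γ B) f x))
    → (idA : Category._⇒_ V (SymmetricMonoidalClosed.unit SMC) (End V SMC complete Γ (El V Γ A) (El V Γ A)))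
    → Corresponds V SMC complete Γ (El V Γ A) (El V Γ A) idA (λ x → Category.id V)
    → (fg : Category._⇒_ V (SymmetricMonoidalClosed.unit SMC) (End V SMC complete Γ (El V Γ B) (El V Γ B)))
    → Corresponds V SMC complete Γ (El V Γ B) (El V Γ B) fg
    (λ x → Category._∘_ V (toNat V SMC complete Γ (El V Γ A) (El V Γ B) f x)
    (toNat V SMC complete Γ (El V Γ B) (El V Γ A) g x))
    → (idB : Category._⇒_ V (SymmetricMonoidalClosed.unit SMC) (End V SMC complete Γ (El V Γ B) (El V Γ B)))
    → Corresponds V SMC complete Γ (El V Γ B) (El V Γ B) idB (λ x → Category.id V)
    → IdSection (σ V SMC complete Γ (El V Γ A) (El V Γ A) gf) (σ V SMC complete Γ (El V Γ A) (El V Γ A) idA)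
    → IdSection (σ V SMC complete Γ (El V Γ B) (El V Γ B) fg) (σ V SMC complete Γ (El V Γ B) (El V Γ B) idB)
    → NatIso (El V Γ A) (El V Γ B)
mainTheorem8 V SMC complete _ Γ A B f g _ gf gf~g∘f idA idA~id fg fg~f∘g idB idB~id p q = record
  { F⇒G  = toNatTrans (El V Γ A) (El V Γ B) f
  ; F⇐G  = toNatTrans (El V Γ B) (El V Γ A) g
  ; isoˡ = identified-correspond (El V Γ A) (El V Γ A) gf~g∘f idA~id p
  ; isoʳ = identified-correspond (El V Γ B) (El V Γ B) fg~f∘g idB~id q
  }
  where open EndElements V SMC complete Γ
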